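{- Let $G$ be an acyclically edge $k$-critical graph with $k>\Delta(G)$, and let $v$ be a vertex of $G$ of degree $2$. Then every neighbor of $v$ has degree at least $k-\Delta(G)+3$.
   Context: All graphs are finite and simple. A proper edge coloring is acyclic if there is no cycle whose edges use only two colors. $\chi'_a(G)$ is the least $k$ such that $G$ has an acyclic proper edge coloring with colors from $\{1,\dots,k\}$. A graph $G$ is acyclically edge $k$-critical if $\chi'_a(G)>k$ and every proper subgraph of $G$ has an acyclic proper edge coloring with colors from $\{1,\dots,k\}$. $\Delta(G)$ is the maximum degree of $G$. -}

module Defs where

open import Data.Nat using (ℕ; zero; suc; _+_; _<_; _⊔_; s≤s)
open import Data.Nat.Properties using (_<?_)
open import Data.Fin using (Fin; toℕ; fromℕ<)
open import Data.List using (List; map; foldr; allFin)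
open import Data.Nat.ListAction using (sum)
open import Data.Bool using (Bool; true; false; if_then_else_)
open import Data.Product using (Σ; _×_; ∃; ∃-syntax)
open import Data.Sum using (_⊎_)
open import Relation.Nullary using (¬_; yes; no)
open import Relation.Binary.PropositionalEquality using (_≡_; _≢_)
open import Function.Definitions using (Injective)

record Graph : Set where
  field
    n      : ℕ
    adj    : Fin n → Fin n → Bool
    sym    : ∀ u v → adj u v ≡ adj v u
    irrefl : ∀ v → adj v v ≡ false
open Graph public

Edge : (G : Graph) → Fin (n G) → Fin (n G) → Set
Edge G u v = adj G u v ≡ true

deg : (G : Graph) → Fin (n G) → ℕ
deg G v = sum (map (λ u → if adj G v u then 1 else 0) (allFin (n G)))

-- maximum degree (0 for the empty graph)
Δ : Graph → ℕ
Δ G = foldr _⊔_ 0 (map (deg G) (allFin (n G)))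

-- An edge colouring with colours from Fin k (i.e. {1,…,k}): a colour for every
-- ordered pair, only relevant on edges, required symmetric on edges.
record EdgeColouring (G : Graph) (k : ℕ) : Set where
  field
    col    : Fin (n G) → Fin (n G) → Fin k
    colSym : ∀ u v → Edge G u v → col u v ≡ col v u
open EdgeColouring public

Proper : ∀ {G k} → EdgeColouring G k → Set
Proper {G} c = ∀ u v w → Edge G u v → Edge G u w → v ≢ w → col c u v ≢ col c u w

next : ∀ {m} → Fin (suc m) → Fin (suc m)
next {m} i with suc (toℕ i) <? suc m
... | yes p = fromℕ< p
... | no _  = Fin.zero

record Cycle (G : Graph) : Set where
  field
    l      : ℕ
    p      : Fin (3 + l) → Fin (n G)
    pInj   : Injective _≡_ _≡_ p
    pAdj   : ∀ i → Edge G (p i) (p (next i))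
open Cycle public

Bichromatic : ∀ {G k} → EdgeColouring G k → Cycle G → Set
Bichromatic {G} {k} c C =
  Σ (Fin k) λ a → Σ (Fin k) λ b →
    ∀ i → (col c (p C i) (p C (next i)) ≡ a) ⊎ (col c (p C i) (p C (next i)) ≡ b)

Acyclic : ∀ {G k} → EdgeColouring G k → Set
Acyclic {G} c = (C : Cycle G) → ¬ Bichromatic c C

AcyclicallyColourable : Graph → ℕ → Set
AcyclicallyColourable G k = Σ (EdgeColouring G k) λ c → Proper c × Acyclic c

record Subgraph (G : Graph) : Set where
  field
    H     : Graph
    f     : Fin (n H) → Fin (n G)
    fInj  : Injective _≡_ _≡_ f
    fEdge : ∀ x y → Edge H x y → Edge G (f x) (f y)
open Subgraph public

ProperSubgraph : (G : Graph) → Subgraph G → Set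
ProperSubgraph G S =
  (n (H S) < n G) ⊎
  (∃[ x ] ∃[ y ] (Edge G (f S x) (f S y) × adj (H S) x y ≡ false))

AcyclicallyEdgeCritical : Graph → ℕ → Set
AcyclicallyEdgeCritical G k =
  ¬ AcyclicallyColourable G k ×
  ((S : Subgraph G) → ProperSubgraph G S → AcyclicallyColourable (H S) k)

module Submission where

-- Suppose deg u ≤ a₀ + 2 with a₀ = k − Δ ≥ 1, and let c be an acyclic proper
-- colouring of H = G minus the edges at v (criticality).  If α is missing at
-- u and β ≠ α at w, colouring vu, vw by α, β is proper, hence not acyclic, so
-- H has an (α, β)-alternating path from w to u.  Counting colours with this
-- fact: every colour is seen at u or w; two colours β₁ ≠ β₂ of edges uy₁, uy₂
-- are unseen at w; some α is missing at u; yᵢ sees only βᵢ and the colours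
-- missing at u.  Exchanging β₁, β₂ on uy₁, uy₂ keeps c proper and acyclic, and
-- comparing the (α, β₁)-paths of both colourings forces β₁ to be seen at y₂.

open import Defs hiding (H) renaming (sym to adj-sym)
open import Data.Nat using (ℕ; zero; suc; _+_; _∸_; _<_; _≤_; _⊔_; z≤n; s≤s)
open import Data.Nat.Properties
open import Data.Fin as Fin using (Fin; toℕ)
open import Data.Fin.Properties using (any?; toℕ-fromℕ<; toℕ-injective; toℕ<n)
  renaming (_≟_ to _≟ᶠ_; suc-injective to Fin-suc-injective)
open import Data.Fin.Permutation.Components using (transpose; transpose-inverse)
open import Data.List using (map; foldr; allFin; tabulate)
open import Data.List.Properties using (map-tabulate)
open import Data.Nat.ListAction using (sum)
open import Data.Bool using (Bool; true; false; _∧_; not; if_then_else_) renaming (_≟_ to _≟ᵇ_)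
open import Data.Bool.Properties using (∧-comm; ∧-zeroʳ; ∧-conicalˡ; ∧-conicalʳ)
open import Data.Product using (Σ; _×_; _,_; proj₁; proj₂; ∃)
open import Data.Sum using (_⊎_; inj₁; inj₂)
open import Data.Empty using (⊥; ⊥-elim)
open import Data.Unit using (tt)
open import Level using (0ℓ)
open import Relation.Nullary using (¬_; Dec; yes; no; does; ¬?; _×-dec_; _⊎-dec_)
open import Relation.Nullary.Decidable using (dec-true; dec-false)
open import Relation.Unary using (Pred; Decidable; _⊆_)
open import Relation.Binary.PropositionalEquality
open import Function using (_∘_; id)
open import Algebra.Properties.CommutativeSemigroup +-commutativeSemigroup using (interchange; xy∙z≈xz∙y)

sumᶠ : ∀ {n} → (Fin n → ℕ) → ℕ
sumᶠ {zero}  h = 0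
sumᶠ {suc n} h = h Fin.zero + sumᶠ (h ∘ Fin.suc)

sumᶠ-mono : ∀ {n} {f g : Fin n → ℕ} → (∀ i → f i ≤ g i) → sumᶠ f ≤ sumᶠ g
sumᶠ-mono {zero}  h = z≤n
sumᶠ-mono {suc n} h = +-mono-≤ (h Fin.zero) (sumᶠ-mono (h ∘ Fin.suc))

sumᶠ-+ : ∀ {n} (f g : Fin n → ℕ) → sumᶠ (λ i → f i + g i) ≡ sumᶠ f + sumᶠ g
sumᶠ-+ {zero}  f g = refl
sumᶠ-+ {suc n} f g = trans (cong (f Fin.zero + g Fin.zero +_) (sumᶠ-+ (f ∘ Fin.suc) (g ∘ Fin.suc)))
                             (interchange (f Fin.zero) (g Fin.zero) (sumᶠ (f ∘ Fin.suc)) (sumᶠ (g ∘ Fin.suc)))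

sumᶠ-cong : ∀ {n} {f g : Fin n → ℕ} → (∀ i → f i ≡ g i) → sumᶠ f ≡ sumᶠ g
sumᶠ-cong {zero}  h = refl
sumᶠ-cong {suc n} h = cong₂ _+_ (h Fin.zero) (sumᶠ-cong (h ∘ Fin.suc))

sumᶠ-≥ : ∀ {n} (f : Fin n → ℕ) (x : Fin n) → f x ≤ sumᶠ f
sumᶠ-≥ f Fin.zero    = m≤m+n _ _
sumᶠ-≥ f (Fin.suc x) = ≤-trans (sumᶠ-≥ (f ∘ Fin.suc) x) (m≤n+m _ _)

𝟙 : ∀ {A : Set} → Dec A → ℕ
𝟙 (yes _) = 1
𝟙 (no _)  = 0

count : ∀ {n} {P : Pred (Fin n) 0ℓ} → Decidable P → ℕ
count P? = sumᶠ (λ i → 𝟙 (P? i))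

module _ {n : ℕ} {P Q : Pred (Fin n) 0ℓ} (P? : Decidable P) (Q? : Decidable Q) where

  count-mono : P ⊆ Q → count P? ≤ count Q?
  count-mono P⊆Q = sumᶠ-mono λ i → pointwise (P? i) (Q? i)
    where
    pointwise : ∀ {i} (p : Dec (P i)) (q : Dec (Q i)) → 𝟙 p ≤ 𝟙 q
    pointwise (yes p) (yes _) = ≤-refl
    pointwise (yes p) (no ¬q) = ⊥-elim (¬q (P⊆Q p))
    pointwise (no _)  _       = z≤n

  count-⊎ : count (λ i → P? i ⊎-dec Q? i) ≤ count P? + count Q?
  count-⊎ = ≤-trans (sumᶠ-mono λ i → pointwise (P? i) (Q? i))
                    (≤-reflexive (sumᶠ-+ (λ i → 𝟙 (P? i)) (λ i → 𝟙 (Q? i))))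
    where
    pointwise : ∀ {i} (p : Dec (P i)) (q : Dec (Q i)) → 𝟙 (p ⊎-dec q) ≤ 𝟙 p + 𝟙 q
    pointwise (yes _) _       = s≤s z≤n
    pointwise (no _)  (yes _) = ≤-refl
    pointwise (no _)  (no _)  = z≤n

  count-disjoint : (∀ i → ¬ (P i × Q i)) → count P? + count Q? ≤ count (λ i → P? i ⊎-dec Q? i)
  count-disjoint disj = ≤-trans (≤-reflexive (sym (sumᶠ-+ (λ i → 𝟙 (P? i)) (λ i → 𝟙 (Q? i)))))
                                (sumᶠ-mono λ i → pointwise (P? i) (Q? i))
    where
    pointwise : ∀ {i} (p : Dec (P i)) (q : Dec (Q i)) → 𝟙 p + 𝟙 q ≤ 𝟙 (p ⊎-dec q)
    pointwise (yes p) (yes q) = ⊥-elim (disj _ (p , q))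
    pointwise (yes _) (no _)  = ≤-refl
    pointwise (no _)  (yes _) = ≤-refl
    pointwise (no _)  (no _)  = z≤n

count-cong : ∀ {n} {P Q : Pred (Fin n) 0ℓ} (P? : Decidable P) (Q? : Decidable Q) →
  P ⊆ Q → Q ⊆ P → count P? ≡ count Q?
count-cong P? Q? P⊆Q Q⊆P = ≤-antisym (count-mono P? Q? P⊆Q) (count-mono Q? P? Q⊆P)

count-all : ∀ {n} → count {n} (λ _ → yes tt) ≡ n
count-all {zero}  = refl
count-all {suc n} = cong suc (count-all {n})

count-cover : ∀ {n} {P Q : Pred (Fin n) 0ℓ} (P? : Decidable P) (Q? : Decidable Q) →
  (∀ i → P i ⊎ Q i) → n ≤ count P? + count Q?
count-cover {n} P? Q? cover = begin
  n                                  ≡⟨ count-all ⟨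
  count {n} (λ _ → yes tt)           ≤⟨ count-mono {n} (λ _ → yes tt) (λ i → P? i ⊎-dec Q? i) (λ {i} _ → cover i) ⟩
  count (λ i → P? i ⊎-dec Q? i)      ≤⟨ count-⊎ P? Q? ⟩
  count P? + count Q?                ∎
  where open ≤-Reasoning

count-singleton : ∀ {n} (x : Fin n) → count (_≟ᶠ x) ≡ 1
count-singleton {suc n} Fin.zero    = cong (1 +_) (nobody n)
  where
  nobody : ∀ m → count {m} (λ i → Fin.suc i ≟ᶠ Fin.zero) ≡ 0
  nobody zero    = refl
  nobody (suc m) = nobody m
count-singleton {suc n} (Fin.suc x) =
  trans (count-cong (λ i → Fin.suc i ≟ᶠ Fin.suc x) (_≟ᶠ x) Fin-suc-injective (cong Fin.suc))
        (count-singleton x)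

count-≥1 : ∀ {n} {P : Pred (Fin n) 0ℓ} (P? : Decidable P) {x} → P x → 1 ≤ count P?
count-≥1 {P = P} P? {x} px = ≤-trans (one (P? x)) (sumᶠ-≥ _ x)
  where
  one : (d : Dec (P x)) → 1 ≤ 𝟙 d
  one (yes _)  = ≤-refl
  one (no ¬px) = ⊥-elim (¬px px)

count-witness : ∀ {n} {P : Pred (Fin n) 0ℓ} (P? : Decidable P) → 1 ≤ count P? → ∃ P
count-witness {suc n} P? h with P? Fin.zero
... | yes p = Fin.zero , p
... | no _  = let (i , q) = count-witness (P? ∘ Fin.suc) h in Fin.suc i , q

count-zero : ∀ {n} {P : Pred (Fin n) 0ℓ} (P? : Decidable P) → count P? ≡ 0 → ∀ x → ¬ P x
count-zero P? c≡0 x px with subst (1 ≤_) c≡0 (count-≥1 P? px)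
... | ()

_∖?_ : ∀ {n} {P : Pred (Fin n) 0ℓ} → Decidable P → (x : Fin n) → Decidable (λ i → P i × ¬ i ≡ x)
(P? ∖? x) i = P? i ×-dec ¬? (i ≟ᶠ x)

count-remove : ∀ {n} {P : Pred (Fin n) 0ℓ} (P? : Decidable P) {x} → P x → count (P? ∖? x) + 1 ≡ count P?
count-remove {P = P} P? {x} px = begin
  count (P? ∖? x) + 1                                ≡⟨ cong (count (P? ∖? x) +_) (count-singleton x) ⟨
  count (P? ∖? x) + count (_≟ᶠ x)                    ≡⟨ ≤-antisym
                                                          (count-disjoint (P? ∖? x) (_≟ᶠ x) (λ i (p , q) → proj₂ p q))
                                                                  (count-⊎ (P? ∖? x) (_≟ᶠ x)) ⟩
  count (λ i → (P? ∖? x) i ⊎-dec (i ≟ᶠ x))           ≡⟨ count-cong _ P? split⁻¹ split ⟩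
  count P?                                           ∎
  where
  open ≡-Reasoning
  split : ∀ {i} → P i → (P i × ¬ i ≡ x) ⊎ i ≡ x
  split {i} pi with i ≟ᶠ x
  ... | yes i≡x = inj₂ i≡x
  ... | no  i≢x = inj₁ (pi , i≢x)
  split⁻¹ : ∀ {i} → (P i × ¬ i ≡ x) ⊎ i ≡ x → P i
  split⁻¹ (inj₁ (pi , _)) = pi
  split⁻¹ (inj₂ refl)     = px

count-inj : ∀ {a b} {P : Pred (Fin a) 0ℓ} {Q : Pred (Fin b) 0ℓ} (P? : Decidable P) (Q? : Decidable Q)
  (f : Fin a → Fin b) → (∀ {i} → P i → Q (f i)) → (∀ {i j} → P i → P j → f i ≡ f j → i ≡ j) →
  count P? ≤ count Q?
count-inj {zero}  P? Q? f maps inj = z≤n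
count-inj {suc a} {P = P} {Q} P? Q? f maps inj with P? Fin.zero
... | no _  = count-inj (P? ∘ Fin.suc) Q? (f ∘ Fin.suc) maps λ pi pj e → Fin-suc-injective (inj pi pj e)
... | yes p₀ = begin
  1 + count (P? ∘ Fin.suc)  ≤⟨ s≤s (count-inj (P? ∘ Fin.suc) (Q? ∖? f Fin.zero) (f ∘ Fin.suc) maps′ inj′) ⟩
  1 + count (Q? ∖? f Fin.zero)  ≡⟨ +-comm 1 _ ⟩
  count (Q? ∖? f Fin.zero) + 1  ≡⟨ count-remove Q? (maps p₀) ⟩
  count Q?                      ∎
  where
  open ≤-Reasoning
  maps′ : ∀ {i} → P (Fin.suc i) → Q (f (Fin.suc i)) × ¬ f (Fin.suc i) ≡ f Fin.zero
  maps′ {i} pi = maps pi , λ e → zero≢suc (inj p₀ pi (sym e))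
    where
    zero≢suc : ¬ Fin.zero ≡ Fin.suc i
    zero≢suc ()
  inj′ : ∀ {i j} → P (Fin.suc i) → P (Fin.suc j) → f (Fin.suc i) ≡ f (Fin.suc j) → i ≡ j
  inj′ pi pj e = Fin-suc-injective (inj pi pj e)

count-two : ∀ {n} {P : Pred (Fin n) 0ℓ} (P? : Decidable P) → 2 ≤ count P? →
  Σ (Fin n) λ i → Σ (Fin n) λ j → P i × P j × ¬ i ≡ j
count-two P? c≥2 with count-witness P? (≤-trans (s≤s z≤n) c≥2)
... | i , pi with count-witness (P? ∖? i) (≤-pred (subst (2 ≤_) (trans (sym (count-remove P? pi)) (+-comm _ 1)) c≥2))
... | j , pj , j≢i = i , j , pi , pj , λ i≡j → j≢i (sym i≡j)

count-exactly-two : ∀ {n} {P : Pred (Fin n) 0ℓ} (P? : Decidable P) → count P? ≡ 2 → ∀ {u} → P u →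
  Σ (Fin n) λ w → P w × ¬ w ≡ u × (∀ x → P x → x ≡ u ⊎ x ≡ w)
count-exactly-two {n} {P} P? c≡2 {u} pu = name-other (count-witness (P? ∖? u) (≤-reflexive (sym one-left)))
  where
  one-left : count (P? ∖? u) ≡ 1
  one-left = +-cancelʳ-≡ 1 _ _ (trans (count-remove P? pu) c≡2)
  name-other : ∃ (λ i → P i × ¬ i ≡ u) → Σ (Fin n) λ w → P w × ¬ w ≡ u × (∀ x → P x → x ≡ u ⊎ x ≡ w)
  name-other (w , pw , w≢u) = w , pw , w≢u , only
    where
    none-left : count ((P? ∖? u) ∖? w) ≡ 0
    none-left = +-cancelʳ-≡ 1 _ _ (trans (count-remove (P? ∖? u) (pw , w≢u)) one-left)
    only : ∀ x → P x → x ≡ u ⊎ x ≡ w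
    only x px with x ≟ᶠ u | x ≟ᶠ w
    ... | yes x≡u | _       = inj₁ x≡u
    ... | no _    | yes x≡w = inj₂ x≡w
    ... | no x≢u  | no x≢w  = ⊥-elim (count-zero _ none-left x ((px , x≢u) , x≢w))

OneOf : ∀ {k} → Fin k → Fin k → Fin k → Set
OneOf a b x = x ≡ a ⊎ x ≡ b

edge-sym : ∀ (X : Graph) {x y} → Edge X x y → Edge X y x
edge-sym X {x} {y} e = trans (adj-sym X y x) e

edge-irrefl : ∀ (X : Graph) {x y} → Edge X x y → ¬ x ≡ y
edge-irrefl X {x} e refl with trans (sym (irrefl X x)) e
... | ()

next-toℕ : ∀ {m} (x : Fin (suc m)) →
  toℕ (next x) ≡ suc (toℕ x) ⊎ (suc (toℕ x) ≡ suc m × toℕ (next x) ≡ 0)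
next-toℕ {m} x with suc (toℕ x) <? suc m
... | yes p = inj₁ (toℕ-fromℕ< p)
... | no ¬p = inj₂ (≤-antisym (toℕ<n x) (≮⇒≥ ¬p) , refl)

next^ : ∀ {m} → ℕ → Fin (suc m) → Fin (suc m)
next^ zero    x = x
next^ (suc d) x = next (next^ d x)

next^-toℕ : ∀ {m} (x : Fin (suc m)) d → d ≤ suc m →
  toℕ (next^ d x) ≡ toℕ x + d ⊎ toℕ (next^ d x) + suc m ≡ toℕ x + d
next^-toℕ x zero _ = inj₁ (sym (+-identityʳ _))
next^-toℕ {m} x (suc d) d<N with next^-toℕ x d (≤-trans (n≤1+n d) d<N) | next-toℕ (next^ d x)
... | inj₁ e | inj₁ e′ = inj₁ (trans e′ (trans (cong suc e) (sym (+-suc _ d))))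
... | inj₁ e | inj₂ (wrap , e′) = inj₂ (trans (cong (_+ suc m) e′) (trans (sym wrap) (trans (cong suc e) (sym (+-suc _ d)))))
... | inj₂ e | inj₁ e′ = inj₂ (trans (cong (_+ suc m) e′) (trans (cong suc e) (sym (+-suc _ d))))
... | inj₂ e | inj₂ (wrap , _) = ⊥-elim (<-irrefl refl (begin-strict
      suc (toℕ x + d)            <⟨ s≤s (+-mono-<-≤ (toℕ<n x) (≤-pred d<N)) ⟩
      suc (suc m + m)            ≡⟨ cong (λ t → suc (t + m)) wrap ⟨
      suc (suc y + m)            ≡⟨ cong suc (+-suc y m) ⟨
      suc (y + suc m)            ≡⟨ cong suc e ⟩
      suc (toℕ x + d)            ∎))
  where
  open ≤-Reasoning
  y = toℕ (next^ d x)

next^-full : ∀ {m} (x : Fin (suc m)) → next^ (suc m) x ≡ x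
next^-full {m} x with next^-toℕ x (suc m) ≤-refl
... | inj₁ e = ⊥-elim (<-irrefl refl (≤-trans (subst (_< suc m) e (toℕ<n (next^ (suc m) x))) (m≤n+m (suc m) (toℕ x))))
... | inj₂ e = toℕ-injective (+-cancelʳ-≡ (suc m) _ _ e)

wrapped-once : ∀ {s t a b N} → s ≡ t + a → s + N ≡ t + b → b < N → ⊥
wrapped-once {s} {t} {a} {b} {N} e e′ b<N = <-irrefl refl (≤-trans b<N (≤-trans (m≤n+m N a) (≤-reflexive a+N≡b)))
  where
  a+N≡b : a + N ≡ b
  a+N≡b = +-cancelˡ-≡ t _ _ (trans (sym (+-assoc t a N)) (trans (cong (_+ N) (sym e)) e′))

next^-injective : ∀ {m} (x : Fin (suc m)) {d₁ d₂} → d₁ < suc m → d₂ < suc m →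
  next^ d₁ x ≡ next^ d₂ x → d₁ ≡ d₂
next^-injective {m} x {d₁} {d₂} d₁<N d₂<N eq
  with next^-toℕ x d₁ (<⇒≤ d₁<N) | next^-toℕ x d₂ (<⇒≤ d₂<N)
... | inj₁ e₁ | inj₁ e₂ = +-cancelˡ-≡ (toℕ x) _ _ (trans (sym e₁) (trans (cong toℕ eq) e₂))
... | inj₂ e₁ | inj₂ e₂ = +-cancelˡ-≡ (toℕ x) _ _ (trans (sym e₁) (trans (cong (λ z → toℕ z + suc m) eq) e₂))
... | inj₁ e₁ | inj₂ e₂ = ⊥-elim (wrapped-once (trans (sym (cong toℕ eq)) e₁) e₂ d₂<N)
... | inj₂ e₁ | inj₁ e₂ = ⊥-elim (wrapped-once (trans (cong toℕ eq) e₂) e₁ d₁<N)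

-- A cycle of length N = 3 + len read off as a periodic sequence of vertices
-- starting at r 0: the first N entries are distinct, consecutive ones are
-- adjacent, and r N = r 0.  This makes rotation and reversal easy.
record CycleSeq (X : Graph) : Set where
  field
    len    : ℕ
    r      : ℕ → Fin (n X)
    closed : r (3 + len) ≡ r 0
    inj    : ∀ {i j} → i < 3 + len → j < 3 + len → r i ≡ r j → i ≡ j
    edge   : ∀ {j} → j < 3 + len → Edge X (r j) (r (suc j))
open CycleSeq public

TwoColoured : ∀ {X k} → EdgeColouring X k → Fin k → Fin k → CycleSeq X → Set
TwoColoured c a b S = ∀ {j} → j < 3 + len S → OneOf a b (col c (r S j) (r S (suc j)))

rotate : ∀ {X} (C : Cycle X) → Fin (3 + l C) → CycleSeq X
rotate C i = record
  { len    = l C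
  ; r      = λ j → p C (next^ j i)
  ; closed = cong (p C) (next^-full i)
  ; inj    = λ d₁<N d₂<N e → next^-injective i d₁<N d₂<N (pInj C e)
  ; edge   = λ {j} _ → pAdj C (next^ j i)
  }

rotate-twoColoured : ∀ {X k} {c : EdgeColouring X k} {a b} (C : Cycle X) i →
  (∀ i → OneOf a b (col c (p C i) (p C (next i)))) → TwoColoured c a b (rotate C i)
rotate-twoColoured C i bc {j} _ = bc (next^ j i)

N∸j≡1+N∸[1+j] : ∀ {N j} → j < N → N ∸ j ≡ suc (N ∸ suc j)
N∸j≡1+N∸[1+j] (s≤s j≤) = +-∸-assoc 1 j≤

N∸[1+j]<N : ∀ {N} j → 0 < N → N ∸ suc j < N
N∸[1+j]<N {suc N} j _ = s≤s (m∸n≤m N j)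

reverse : ∀ {X} → CycleSeq X → CycleSeq X
reverse {X} S = record
  { len    = len S
  ; r      = λ j → r S (N ∸ j)
  ; closed = trans (cong (r S) (n∸n≡0 N)) (sym (closed S))
  ; inj    = inj′
  ; edge   = λ {j} j<N → subst (λ t → Edge X (r S t) (r S (N ∸ suc j))) (sym (N∸j≡1+N∸[1+j] j<N))
                             (edge-sym X (edge S (N∸[1+j]<N j (s≤s z≤n))))
  }
  where
  N = 3 + len S
  start : ∀ {j} → suc j < N → ¬ r S 0 ≡ r S (N ∸ suc j)
  start {j} 1+j<N e with inj S (s≤s z≤n) (N∸[1+j]<N j (s≤s z≤n)) e
  ... | 0≡N∸[1+j] = <-irrefl 0≡N∸[1+j] (m<n⇒0<n∸m 1+j<N)
  inj′ : ∀ {i j} → i < N → j < N → r S (N ∸ i) ≡ r S (N ∸ j) → i ≡ j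
  inj′ {zero}  {zero}  _   _   _ = refl
  inj′ {zero}  {suc j} _   j<N e = ⊥-elim (start j<N (trans (sym (closed S)) e))
  inj′ {suc i} {zero}  i<N _   e = ⊥-elim (start i<N (trans (sym (closed S)) (sym e)))
  inj′ {suc i} {suc j} i<N j<N e =
    ∸-cancelˡ-≡ (<⇒≤ i<N) (<⇒≤ j<N) (inj S (N∸[1+j]<N i (s≤s z≤n)) (N∸[1+j]<N j (s≤s z≤n)) e)

reverse-twoColoured : ∀ {X k} {c : EdgeColouring X k} {a b} (S : CycleSeq X) →
  TwoColoured c a b S → TwoColoured c a b (reverse S)
reverse-twoColoured {X} {c = c} {a} {b} S tc {j} j<N =
  subst (λ t → OneOf a b (col c (r S t) (r S (N ∸ suc j)))) (sym (N∸j≡1+N∸[1+j] j<N))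
    (subst (OneOf a b) (colSym c _ _ (edge S (N∸[1+j]<N j (s≤s z≤n)))) (tc (N∸[1+j]<N j (s≤s z≤n))))
  where
  N = 3 + len S

edge-to-last : ∀ {X} (S : CycleSeq X) → Edge X (r S 0) (r S (2 + len S))
edge-to-last {X} S = subst (λ t → Edge X t (r S (2 + len S))) (closed S) (edge-sym X (edge S ≤-refl))

second≢last : ∀ {X} (S : CycleSeq X) → ¬ r S 1 ≡ r S (2 + len S)
second≢last S e with inj S (s≤s (s≤s z≤n)) ≤-refl e
... | ()

r-next : ∀ {X} (S : CycleSeq X) (i : Fin (3 + len S)) → r S (suc (toℕ i)) ≡ r S (toℕ (next i))
r-next S i with next-toℕ i
... | inj₁ e = cong (r S) (sym e)
... | inj₂ (wrap , e) = trans (cong (r S) wrap) (trans (closed S) (cong (r S) (sym e)))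

toCycle : ∀ {X} → CycleSeq X → Cycle X
toCycle {X} S = record
  { l    = len S
  ; p    = λ i → r S (toℕ i)
  ; pInj = λ {i} {j} e → toℕ-injective (inj S (toℕ<n i) (toℕ<n j) e)
  ; pAdj = λ i → subst (Edge X (r S (toℕ i))) (r-next S i) (edge S (toℕ<n i))
  }

acyclic-noTwoColoured : ∀ {X k} {c : EdgeColouring X k} → Acyclic c →
  ∀ (S : CycleSeq X) {a b} → ¬ TwoColoured c a b S
acyclic-noTwoColoured {X} {c = c} acyc S {a} {b} tc = acyc (toCycle S) (a , b , bc)
  where
  bc : ∀ i → OneOf a b (col c (r S (toℕ i)) (r S (toℕ (next i))))
  bc i = subst (λ t → OneOf a b (col c (r S (toℕ i)) t)) (r-next S i) (tc (toℕ<n i))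

alt : ∀ {k} → Fin k → Fin k → ℕ → Fin k
alt x y zero    = x
alt x y (suc j) = alt y x j

alt-cases : ∀ {k} (x y : Fin k) j → (alt x y j ≡ x × alt y x j ≡ y) ⊎ (alt x y j ≡ y × alt y x j ≡ x)
alt-cases x y zero = inj₁ (refl , refl)
alt-cases x y (suc j) with alt-cases y x j
... | inj₁ (e₁ , e₂) = inj₂ (e₁ , e₂)
... | inj₂ (e₁ , e₂) = inj₁ (e₁ , e₂)

alt-oneOf : ∀ {k} {a b x y : Fin k} → OneOf a b x → OneOf a b y → ∀ j → OneOf a b (alt x y j)
alt-oneOf ox oy j with alt-cases _ _ j
... | inj₁ (e , _) = subst (OneOf _ _) (sym e) ox
... | inj₂ (e , _) = subst (OneOf _ _) (sym e) oy

alt-≢ : ∀ {k} {x y : Fin k} → ¬ x ≡ y → ∀ j → ¬ alt x y j ≡ alt y x j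
alt-≢ x≢y j e with alt-cases _ _ j
... | inj₁ (e₁ , e₂) = x≢y (trans (sym e₁) (trans e e₂))
... | inj₂ (e₁ , e₂) = x≢y (trans (sym e₂) (trans (sym e) e₁))

other-colour : ∀ {k} {a b x y z : Fin k} → OneOf a b z → OneOf a b x → OneOf a b y →
  ¬ x ≡ y → ¬ z ≡ x → z ≡ y
other-colour (inj₁ refl) (inj₁ refl) _           _   z≢x = ⊥-elim (z≢x refl)
other-colour (inj₁ refl) (inj₂ refl) (inj₁ refl) _   _   = refl
other-colour (inj₁ refl) (inj₂ refl) (inj₂ refl) x≢y _   = ⊥-elim (x≢y refl)
other-colour (inj₂ refl) (inj₂ refl) _           _   z≢x = ⊥-elim (z≢x refl)
other-colour (inj₂ refl) (inj₁ refl) (inj₂ refl) _   _   = refl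
other-colour (inj₂ refl) (inj₁ refl) (inj₁ refl) x≢y _   = ⊥-elim (x≢y refl)

-- The two neighbours of r (suc j) on the cycle are distinct (cycles have
-- length at least 3).
r-skip : ∀ {X} (S : CycleSeq X) {j} → suc j < 3 + len S → ¬ r S j ≡ r S (suc (suc j))
r-skip S {j} 1+j<N e with suc (suc j) <? 3 + len S
... | yes 2+j<N with inj S (≤-trans (n≤1+n _) (<⇒≤ 2+j<N)) 2+j<N e
...   | ()
r-skip S {j} 1+j<N e | no 2+j≮N with ≤-antisym 1+j<N (≮⇒≥ 2+j≮N)
r-skip S {zero}  _     e | no _ | ()
r-skip S {suc j} 1+j<N e | no _ | 3+j≡N
  with inj S (<-trans (n<1+n _) 1+j<N) (s≤s z≤n) (trans e (trans (cong (r S) 3+j≡N) (closed S)))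
... | ()

alternating : ∀ {X k} {c : EdgeColouring X k} {a b x y} → Proper c → (S : CycleSeq X) →
  TwoColoured c a b S → OneOf a b x → OneOf a b y → ¬ x ≡ y → col c (r S 0) (r S 1) ≡ x →
  ∀ {j} → j < 3 + len S → col c (r S j) (r S (suc j)) ≡ alt x y j
alternating prop S tc ox oy x≢y first {zero} _ = first
alternating {X} {c = c} {a} {b} {x} {y} prop S tc ox oy x≢y first {suc j} 1+j<N =
  other-colour (tc 1+j<N) (alt-oneOf ox oy j) (alt-oneOf oy ox j) (alt-≢ x≢y j) differs
  where
  back : Edge X (r S (suc j)) (r S j)
  back = edge-sym X (edge S (<-trans (n<1+n j) 1+j<N))
  previous : col c (r S j) (r S (suc j)) ≡ alt x y j
  previous = alternating {X} {c = c} {a} {b} {x} {y} prop S tc ox oy x≢y first (<-trans (n<1+n j) 1+j<N)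
  differs : ¬ col c (r S (suc j)) (r S (suc (suc j))) ≡ alt x y j
  differs e = prop _ _ _ (edge S 1+j<N) back (λ e′ → r-skip S 1+j<N (sym e′))
    (trans e (sym (trans (colSym c (r S (suc j)) (r S j) back) previous)))

proper-unique : ∀ {X k} {c : EdgeColouring X k} → Proper c → ∀ {x y z} →
  Edge X x y → Edge X x z → col c x y ≡ col c x z → y ≡ z
proper-unique prop {x} {y} {z} x–y x–z e with y ≟ᶠ z
... | yes y≡z = y≡z
... | no y≢z  = ⊥-elim (prop x y z x–y x–z y≢z e)

sum-allFin : ∀ {n} (h : Fin n → ℕ) → sum (map h (allFin n)) ≡ sumᶠ h
sum-allFin {n} h = trans (cong sum (map-tabulate id h)) (go h)
  where
  go : ∀ {m} (g : Fin m → ℕ) → sum (tabulate g) ≡ sumᶠ g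
  go {zero}  g = refl
  go {suc m} g = cong (g Fin.zero +_) (go (g ∘ Fin.suc))

deg-count : ∀ (G : Graph) x → deg G x ≡ count (λ z → adj G x z ≟ᵇ true)
deg-count G x = trans (sum-allFin (λ z → if adj G x z then 1 else 0)) (sumᶠ-cong λ z → indicator (adj G x z))
  where
  indicator : ∀ b → (if b then 1 else 0) ≡ 𝟙 (b ≟ᵇ true)
  indicator true  = refl
  indicator false = refl

deg≤Δ : ∀ (G : Graph) x → deg G x ≤ Δ G
deg≤Δ G x rewrite map-tabulate {n = n G} id (deg G) = go (deg G) x
  where
  go : ∀ {m} (g : Fin m → ℕ) y → g y ≤ foldr _⊔_ 0 (tabulate g)
  go g Fin.zero    = m≤m⊔n _ _
  go g (Fin.suc y) = ≤-trans (go (g ∘ Fin.suc) y) (m≤n⊔m (g Fin.zero) _)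

other-neighbour : ∀ (G : Graph) {v u} → deg G v ≡ 2 → Edge G v u →
  Σ (Fin (n G)) λ w → Edge G v w × ¬ w ≡ u × (∀ x → Edge G v x → x ≡ u ⊎ x ≡ w)
other-neighbour G {v} deg-v v–u = count-exactly-two (λ z → adj G v z ≟ᵇ true) (trans (sym (deg-count G v)) deg-v) v–u

module DeleteEdgesAt (G : Graph) (v : Fin (n G)) where

  V : Set
  V = Fin (n G)

  away : V → Bool
  away x = not (does (x ≟ᶠ v))

  away-≢ : ∀ {x} → away x ≡ true → ¬ x ≡ v
  away-≢ {x} a e with x ≟ᶠ v
  away-≢ () e | yes _
  ... | no x≢v = x≢v e

  ≢-away : ∀ {x} → ¬ x ≡ v → away x ≡ true
  ≢-away {x} x≢v with x ≟ᶠ v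
  ... | yes e = ⊥-elim (x≢v e)
  ... | no _  = refl

  H : Graph
  H = record
    { n      = n G
    ; adj    = λ x y → adj G x y ∧ (away x ∧ away y)
    ; sym    = λ x y → cong₂ _∧_ (adj-sym G x y) (∧-comm (away x) (away y))
    ; irrefl = λ x → cong (_∧ (away x ∧ away x)) (irrefl G x)
    }

  H⇒G : ∀ {x y} → Edge H x y → Edge G x y
  H⇒G {x} {y} e = ∧-conicalˡ (adj G x y) _ e

  H-avoids : ∀ {x y} → Edge H x y → ¬ x ≡ v
  H-avoids {x} {y} e = away-≢ (∧-conicalˡ (away x) (away y) (∧-conicalʳ (adj G x y) _ e))

  G⇒H : ∀ {x y} → Edge G x y → ¬ x ≡ v → ¬ y ≡ v → Edge H x y
  G⇒H {x} {y} e x≢v y≢v rewrite e | ≢-away x≢v | ≢-away y≢v = refl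

  H-edge? : ∀ x y → Dec (Edge H x y)
  H-edge? x y = adj H x y ≟ᵇ true

  H-subgraph : Subgraph G
  H-subgraph = record { H = H ; f = id ; fInj = id ; fEdge = λ x y → H⇒G }

  H-proper : ∀ {u} → Edge G v u → ProperSubgraph G H-subgraph
  H-proper {u} v–u = inj₂ (v , u , v–u , trans (cong (λ b → adj G v u ∧ (not b ∧ away u)) v≟v) (∧-zeroʳ (adj G v u)))
    where
    v≟v : does (v ≟ᶠ v) ≡ true
    v≟v with v ≟ᶠ v
    ... | yes _  = refl
    ... | no v≢v = ⊥-elim (v≢v refl)

  degH : V → ℕ
  degH x = count (H-edge? x)

  degH≤deg : ∀ x → degH x ≤ deg G x
  degH≤deg x = subst (degH x ≤_) (sym (deg-count G x)) (count-mono (H-edge? x) _ H⇒G)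

  degH<deg : ∀ {x} → Edge G x v → degH x + 1 ≤ deg G x
  degH<deg {x} x–v = begin
    degH x + 1                                   ≡⟨ cong (degH x +_) (count-singleton v) ⟨
    degH x + count (_≟ᶠ v)                       ≤⟨ count-disjoint (H-edge? x) (_≟ᶠ v)
                                                      (λ z (e , z≡v) → H-avoids (edge-sym H e) z≡v) ⟩
    count (λ z → H-edge? x z ⊎-dec (z ≟ᶠ v))     ≤⟨ count-mono (λ z → H-edge? x z ⊎-dec (z ≟ᶠ v)) (λ z → adj G x z ≟ᵇ true)
                                                      (λ { (inj₁ e) → H⇒G e ; (inj₂ refl) → x–v }) ⟩
    count (λ z → adj G x z ≟ᵇ true)              ≡⟨ deg-count G x ⟨
    deg G x                                      ∎
    where open ≤-Reasoning

module TwoNeighbours (G : Graph) (k : ℕ) (v u w : Fin (n G))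
  (v–u : Edge G v u) (v–w : Edge G v w) (w≢u : ¬ w ≡ u)
  (nbrs : ∀ x → Edge G v x → x ≡ u ⊎ x ≡ w) where

  open DeleteEdgesAt G v public

  u≢v : ¬ u ≡ v
  u≢v e = edge-irrefl G v–u (sym e)

  record AltPath (d : EdgeColouring H k) (α β : Fin k) : Set where
    field
      m      : ℕ
      q      : ℕ → V
      start  : q 0 ≡ w
      end    : q m ≡ u
      step   : ∀ {j} → j < m → Edge H (q j) (q (suc j))
      colour : ∀ {j} → j < m → col d (q j) (q (suc j)) ≡ alt α β j
      avoids : ∀ {j} → j < m → ¬ q j ≡ u

  module Extension (d : EdgeColouring H k) (d-proper : Proper d) (α β : Fin k) (α≢β : ¬ α ≡ β)
    (α-free : ∀ {z} → Edge H u z → ¬ col d u z ≡ α)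
    (β-free : ∀ {z} → Edge H w z → ¬ col d w z ≡ β) where

    new : V → Fin k
    new x = if does (x ≟ᶠ u) then α else β

    new-u : new u ≡ α
    new-u with u ≟ᶠ u
    ... | yes _  = refl
    ... | no u≢u = ⊥-elim (u≢u refl)

    new-w : new w ≡ β
    new-w with w ≟ᶠ u
    ... | yes w≡u = ⊥-elim (w≢u w≡u)
    ... | no _    = refl

    ext : V → V → Fin k
    ext x y with x ≟ᶠ v | y ≟ᶠ v
    ... | yes _ | _     = new y
    ... | no _  | yes _ = new x
    ... | no _  | no _  = col d x y

    ext-away : ∀ {x y} → ¬ x ≡ v → ¬ y ≡ v → ext x y ≡ col d x y
    ext-away {x} {y} x≢v y≢v with x ≟ᶠ v | y ≟ᶠ v
    ... | yes x≡v | _       = ⊥-elim (x≢v x≡v)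
    ... | no _    | yes y≡v = ⊥-elim (y≢v y≡v)
    ... | no _    | no _    = refl

    ext-from-v : ∀ y → ext v y ≡ new y
    ext-from-v y with v ≟ᶠ v
    ... | yes _  = refl
    ... | no v≢v = ⊥-elim (v≢v refl)

    ext-to-v : ∀ {x} → ¬ x ≡ v → ext x v ≡ new x
    ext-to-v {x} x≢v with x ≟ᶠ v | v ≟ᶠ v
    ... | yes x≡v | _      = ⊥-elim (x≢v x≡v)
    ... | no _    | yes _  = refl
    ... | no _    | no v≢v = ⊥-elim (v≢v refl)

    ext-sym : ∀ x y → Edge G x y → ext x y ≡ ext y x
    ext-sym x y x–y = by-cases (x ≟ᶠ v) (y ≟ᶠ v)
      where
      by-cases : Dec (x ≡ v) → Dec (y ≡ v) → ext x y ≡ ext y x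
      by-cases (yes refl) (yes refl) = refl
      by-cases (yes refl) (no y≢v)   = trans (ext-from-v y) (sym (ext-to-v y≢v))
      by-cases (no x≢v)   (yes refl) = trans (ext-to-v x≢v) (sym (ext-from-v x))
      by-cases (no x≢v)   (no y≢v)   =
        trans (ext-away x≢v y≢v) (trans (colSym d x y (G⇒H x–y x≢v y≢v)) (sym (ext-away y≢v x≢v)))

    extension : EdgeColouring G k
    extension = record { col = ext ; colSym = ext-sym }

    new-distinct : ∀ {y z} → Edge G v y → Edge G v z → ¬ y ≡ z → ¬ new y ≡ new z
    new-distinct v–y v–z y≢z with nbrs _ v–y | nbrs _ v–z
    ... | inj₁ refl | inj₁ refl = ⊥-elim (y≢z refl)
    ... | inj₂ refl | inj₂ refl = ⊥-elim (y≢z refl)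
    ... | inj₁ refl | inj₂ refl = λ e → α≢β (trans (sym new-u) (trans e new-w))
    ... | inj₂ refl | inj₁ refl = λ e → α≢β (trans (sym new-u) (trans (sym e) new-w))

    new-fresh : ∀ {x z} → Edge G v x → Edge H x z → ¬ new x ≡ col d x z
    new-fresh v–x x–z with nbrs _ v–x
    ... | inj₁ refl = λ e → α-free x–z (sym (trans (sym new-u) e))
    ... | inj₂ refl = λ e → β-free x–z (sym (trans (sym new-w) e))

    extension-proper : Proper extension
    extension-proper x y z x–y x–z y≢z = at-x (x ≟ᶠ v)
      where
      at-x : Dec (x ≡ v) → ¬ ext x y ≡ ext x z
      at-x (yes refl) e = new-distinct x–y x–z y≢z (trans (sym (ext-from-v y)) (trans e (ext-from-v z)))
      at-x (no x≢v) = at-yz (y ≟ᶠ v) (z ≟ᶠ v)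
        where
        at-yz : Dec (y ≡ v) → Dec (z ≡ v) → ¬ ext x y ≡ ext x z
        at-yz (yes refl) (yes refl) _ = y≢z refl
        at-yz (yes refl) (no z≢v) e = new-fresh (edge-sym G x–y) (G⇒H x–z x≢v z≢v)
                                        (trans (sym (ext-to-v x≢v)) (trans e (ext-away x≢v z≢v)))
        at-yz (no y≢v) (yes refl) e = new-fresh (edge-sym G x–z) (G⇒H x–y x≢v y≢v)
                                        (trans (sym (ext-to-v x≢v)) (trans (sym e) (ext-away x≢v y≢v)))
        at-yz (no y≢v) (no z≢v) e = d-proper x y z (G⇒H x–y x≢v y≢v) (G⇒H x–z x≢v z≢v) y≢z
                                        (trans (sym (ext-away x≢v y≢v)) (trans e (ext-away x≢v z≢v)))

    -- A two-coloured cycle of the extension through v, leaving v towards w,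
    -- continues as an (α, β)-alternating path from w back to u.
    module FromCycle (S : CycleSeq G) {a b} (tc : TwoColoured extension a b S)
      (r0 : r S 0 ≡ v) (r1 : r S 1 ≡ w) where

      N = 3 + len S

      off-v : ∀ {j} → 0 < j → j < N → ¬ r S j ≡ v
      off-v {suc j} _ j<N e with inj S j<N (s≤s z≤n) (trans e (sym r0))
      ... | ()

      r-last : r S (2 + len S) ≡ u
      r-last with nbrs _ (subst (λ t → Edge G t _) r0 (edge-to-last S))
      ... | inj₁ e = e
      ... | inj₂ e = ⊥-elim (second≢last S (trans r1 (sym e)))

      first-colour : col extension (r S 0) (r S 1) ≡ β
      first-colour = trans (cong₂ ext r0 r1) (trans (ext-from-v w) new-w)

      last-colour : col extension (r S (2 + len S)) (r S N) ≡ α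
      last-colour = trans (cong₂ ext r-last (trans (closed S) r0)) (trans (ext-to-v u≢v) new-u)

      colours : ∀ {j} → j < N → col extension (r S j) (r S (suc j)) ≡ alt β α j
      colours = alternating {c = extension} extension-proper S tc (subst (OneOf a b) first-colour (tc (s≤s z≤n)))
                  (subst (OneOf a b) last-colour (tc ≤-refl)) (λ e → α≢β (sym e)) first-colour

      path : AltPath d α β
      path = record
        { m      = suc (len S)
        ; q      = λ j → r S (suc j)
        ; start  = r1
        ; end    = r-last
        ; step   = λ j<m → G⇒H (edge S (inner j<m)) (off-v (s≤s z≤n) (inner j<m)) (off-v (s≤s z≤n) (s≤s (s≤s j<m)))
        ; colour = λ j<m → trans (sym (ext-away (off-v (s≤s z≤n) (inner j<m)) (off-v (s≤s z≤n) (s≤s (s≤s j<m)))))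
                                 (colours (inner j<m))
        ; avoids = λ j<m e → <-irrefl (suc-injective (inj S (inner j<m) ≤-refl (trans e (sym r-last)))) j<m
        }
        where
        inner : ∀ {j} → j < suc (len S) → suc j < N
        inner j<m = s≤s (≤-trans j<m (n≤1+n _))

    orient : (S : CycleSeq G) → r S 0 ≡ v → ∀ {a b} → TwoColoured extension a b S →
      Σ (CycleSeq G) λ S′ → TwoColoured extension a b S′ × r S′ 0 ≡ v × r S′ 1 ≡ w
    orient S r0 tc with nbrs _ (subst (λ t → Edge G t (r S 1)) r0 (edge S (s≤s z≤n)))
    ... | inj₂ r1≡w = S , tc , r0 , r1≡w
    ... | inj₁ r1≡u with nbrs _ (subst (λ t → Edge G t _) r0 (edge-to-last S))
    ...   | inj₂ rL≡w = reverse S , reverse-twoColoured {c = extension} S tc , trans (closed S) r0 , rL≡w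
    ...   | inj₁ rL≡u = ⊥-elim (second≢last S (trans r1≡u (sym rL≡u)))

    -- A two-coloured cycle of the extension must pass through v (H's
    -- colouring is acyclic) and hence yields an alternating path.
    path-from-cycle : Acyclic d → (C : Cycle G) → Bichromatic extension C → AltPath d α β
    path-from-cycle d-acyclic C (a , b , bc) with any? (λ i → p C i ≟ᶠ v)
    ... | yes (i , pi≡v) =
          let (S , tc , r0 , r1) = orient (rotate C i) pi≡v (rotate-twoColoured {c = extension} C i bc)
          in FromCycle.path S tc r0 r1
    ... | no avoids-v = ⊥-elim (d-acyclic C-in-H (a , b , λ i → subst (OneOf a b) (ext-away (off i) (off (next i))) (bc i)))
      where
      off : ∀ i → ¬ p C i ≡ v
      off i e = avoids-v (i , e)
      C-in-H : Cycle H
      C-in-H = record { l = l C ; p = p C ; pInj = pInj C ; pAdj = λ i → G⇒H (pAdj C i) (off i) (off (next i)) }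

  module _ {d : EdgeColouring H k} {α β : Fin k} (P : AltPath d α β) where
    open AltPath P

    path-nonempty : 0 < m
    path-nonempty with m | end
    ... | zero  | q0≡u = ⊥-elim (w≢u (trans (sym start) q0≡u))
    ... | suc _ | _    = s≤s z≤n

    path-first : Σ V λ z → Edge H w z × col d w z ≡ α
    path-first = q 1 , subst (λ x → Edge H x (q 1)) start (step path-nonempty)
                     , subst (λ x → col d x (q 1) ≡ α) start (colour path-nonempty)

    Arrival : Set
    Arrival = Σ V λ z → Edge H u z × (col d u z ≡ α ⊎ (col d u z ≡ β × Σ V λ z′ → Edge H z z′ × col d z z′ ≡ α))

    path-last : Arrival
    path-last = from m refl
      where
      last-edge : ∀ j → suc j ≡ m → Edge H (q j) u × col d u (q j) ≡ alt α β j
      last-edge j 1+j≡m =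
        z–u , trans (colSym d u (q j) (edge-sym H z–u)) (subst (λ x → col d (q j) x ≡ alt α β j) arrive (colour j<m))
        where
        j<m : j < m
        j<m = subst (j <_) 1+j≡m ≤-refl
        arrive : q (suc j) ≡ u
        arrive = subst (λ t → q t ≡ u) (sym 1+j≡m) end
        z–u : Edge H (q j) u
        z–u = subst (Edge H (q j)) arrive (step j<m)
      from : ∀ t → t ≡ m → Arrival
      from zero    0≡m = ⊥-elim (<-irrefl 0≡m path-nonempty)
      from (suc zero) 1≡m = let (z–u , c) = last-edge 0 1≡m in q 0 , edge-sym H z–u , inj₁ c
      from (suc (suc i)) 2+i≡m with last-edge (suc i) 2+i≡m | alt-cases α β i
      ... | z–u , c | inj₁ (a , b) = q (suc i) , edge-sym H z–u , inj₂ (trans c b , q i , edge-sym H (step i<m) , back)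
        where
        i<m : i < m
        i<m = subst (i <_) 2+i≡m (n≤1+n _)
        back : col d (q (suc i)) (q i) ≡ α
        back = trans (colSym d (q (suc i)) (q i) (edge-sym H (step i<m))) (trans (colour i<m) a)
      ... | z–u , c | inj₂ (_ , a′) = q (suc i) , edge-sym H z–u , inj₁ (trans c a′)

  -- Criticality: the extension is proper, so it must have a two-coloured
  -- cycle, i.e. the alternating path cannot fail to exist.
  alternating-path : AcyclicallyEdgeCritical G k → (d : EdgeColouring H k) → Proper d → Acyclic d →
    ∀ {α β} → ¬ α ≡ β → (∀ {z} → Edge H u z → ¬ col d u z ≡ α) → (∀ {z} → Edge H w z → ¬ col d w z ≡ β) →
    ¬ ¬ AltPath d α β
  alternating-path crit d d-proper d-acyclic {α} {β} α≢β α-free β-free no-path =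
    proj₁ crit (extension , extension-proper , λ C bc → no-path (path-from-cycle d-acyclic C bc))
    where open Extension d d-proper α β α≢β α-free β-free

  module Counterexample (crit : AcyclicallyEdgeCritical G k)
    (c : EdgeColouring H k) (c-proper : Proper c) (c-acyclic : Acyclic c)
    (D a₀ : ℕ) (k≡a₀+D : k ≡ a₀ + D) (2≤D : 2 ≤ D) (1≤a₀ : 1 ≤ a₀)
    (deg≤D : ∀ x → deg G x ≤ D) (deg-u : deg G u ≤ a₀ + 2) where

    c-unique : ∀ {x y z} → Edge H x y → Edge H x z → col c x y ≡ col c x z → y ≡ z
    c-unique = proper-unique {c = c} c-proper

    Seen : V → Fin k → Set
    Seen x γ = Σ V λ z → Edge H x z × col c x z ≡ γ

    seen? : ∀ x γ → Dec (Seen x γ)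
    seen? x γ = any? (λ z → H-edge? x z ×-dec (col c x z ≟ᶠ γ))

    -- each colour at x is carried by its own edge, as c is proper
    #seen≤degH : ∀ x → count (seen? x) ≤ degH x
    #seen≤degH x = count-inj (seen? x) (H-edge? x) witness witness-edge witness-injective
      where
      witness : Fin k → V
      witness γ with seen? x γ
      ... | yes (z , _) = z
      ... | no _        = x
      witness-edge : ∀ {γ} → Seen x γ → Edge H x (witness γ)
      witness-edge {γ} s with seen? x γ
      ... | yes (_ , x–z , _) = x–z
      ... | no ¬s             = ⊥-elim (¬s s)
      witness-injective : ∀ {γ δ} → Seen x γ → Seen x δ → witness γ ≡ witness δ → γ ≡ δ
      witness-injective {γ} {δ} sγ sδ e with seen? x γ | seen? x δ
      ... | yes (_ , _ , cγ) | yes (_ , _ , cδ) = trans (sym cγ) (trans (cong (col c x) e) cδ)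
      ... | no ¬s | _     = ⊥-elim (¬s sγ)
      ... | yes _ | no ¬s = ⊥-elim (¬s sδ)

    #seen≤D : ∀ x → count (seen? x) ≤ D
    #seen≤D x = ≤-trans (#seen≤degH x) (≤-trans (degH≤deg x) (deg≤D x))

    A B : Fin k → Set
    A = Seen u
    B = Seen w

    #A≤ : count (seen? u) ≤ a₀ + 1
    #A≤ = +-cancelʳ-≤ 1 _ _ (begin
      count (seen? u) + 1  ≤⟨ +-monoˡ-≤ 1 (#seen≤degH u) ⟩
      degH u + 1           ≤⟨ degH<deg (edge-sym G v–u) ⟩
      deg G u              ≤⟨ deg-u ⟩
      a₀ + 2               ≡⟨ +-assoc a₀ 1 1 ⟨
      a₀ + 1 + 1           ∎)
      where open ≤-Reasoning

    #B< : count (seen? w) + 1 ≤ D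
    #B< = ≤-trans (+-monoˡ-≤ 1 (#seen≤degH w)) (≤-trans (degH<deg (edge-sym G v–w)) (deg≤D w))

    complement : ∀ {P Q : Fin k → Set} (P? : ∀ γ → Dec (P γ)) (Q? : ∀ γ → Dec (Q γ)) →
      (∀ γ → P γ ⊎ Q γ) → ∀ {t} → count P? + t ≤ a₀ + D → t ≤ count Q?
    complement P? Q? cover {t} bound = +-cancelˡ-≤ (count P?) t (count Q?)
      (≤-trans bound (subst (_≤ count P? + count Q?) k≡a₀+D (count-cover P? Q? cover)))

    excluded-middle : ∀ {P : Fin k → Set} (P? : ∀ γ → Dec (P γ)) γ → P γ ⊎ ¬ P γ
    excluded-middle P? γ with P? γ
    ... | yes p = inj₁ p
    ... | no ¬p = inj₂ ¬p

    -- Step 1: every colour is seen at u or at w.  Otherwise, for such a γ and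
    -- any β ≠ γ missing at w, the alternating path from w would start in γ.
    seen-somewhere : ∀ γ → A γ ⊎ B γ
    seen-somewhere γ with seen? u γ | seen? w γ
    ... | yes a | _     = inj₁ a
    ... | no _  | yes b = inj₂ b
    ... | no ¬a | no ¬b = ⊥-elim (alternating-path crit c c-proper c-acyclic γ≢β
                                    (λ u–z e → ¬a (_ , u–z , e)) (λ w–z e → β-fresh (inj₁ (_ , w–z , e)))
                                    (λ P → ¬b (path-first P)))
      where
      B∪γ? : ∀ δ → Dec (B δ ⊎ δ ≡ γ)
      B∪γ? δ = seen? w δ ⊎-dec (δ ≟ᶠ γ)
      #B∪γ : count B∪γ? + 1 ≤ a₀ + D
      #B∪γ = begin
        count B∪γ? + 1                       ≤⟨ +-monoˡ-≤ 1 (count-⊎ (seen? w) (_≟ᶠ γ)) ⟩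
        count (seen? w) + count (_≟ᶠ γ) + 1  ≡⟨ cong (λ t → count (seen? w) + t + 1) (count-singleton γ) ⟩
        count (seen? w) + 1 + 1              ≤⟨ +-mono-≤ #B< 1≤a₀ ⟩
        D + a₀                               ≡⟨ +-comm D a₀ ⟩
        a₀ + D                               ∎
        where open ≤-Reasoning
      fresh : ∃ λ δ → ¬ (B δ ⊎ δ ≡ γ)
      fresh = count-witness (λ δ → ¬? (B∪γ? δ)) (complement B∪γ? _ (excluded-middle B∪γ?) #B∪γ)
      β : Fin k
      β = proj₁ fresh
      β-fresh : ¬ (B β ⊎ β ≡ γ)
      β-fresh = proj₂ fresh
      γ≢β : ¬ γ ≡ β
      γ≢β e = β-fresh (inj₂ (sym e))

    A∖B? : ∀ γ → Dec (A γ × ¬ B γ)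
    A∖B? γ = seen? u γ ×-dec ¬? (seen? w γ)

    two-in-A∖B : Σ (Fin k) λ β₁ → Σ (Fin k) λ β₂ → (A β₁ × ¬ B β₁) × (A β₂ × ¬ B β₂) × ¬ β₁ ≡ β₂
    two-in-A∖B = count-two A∖B? (complement (seen? w) A∖B? cover (begin
      count (seen? w) + 2      ≡⟨ +-assoc (count (seen? w)) 1 1 ⟨
      count (seen? w) + 1 + 1  ≤⟨ +-mono-≤ #B< 1≤a₀ ⟩
      D + a₀                   ≡⟨ +-comm D a₀ ⟩
      a₀ + D                   ∎))
      where
      open ≤-Reasoning
      cover : ∀ γ → B γ ⊎ (A γ × ¬ B γ)
      cover γ with seen? w γ | seen-somewhere γ
      ... | yes b | _      = inj₁ b
      ... | no ¬b | inj₁ a = inj₂ (a , ¬b)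
      ... | no ¬b | inj₂ b = ⊥-elim (¬b b)

    missing-at-u : Σ (Fin k) λ α → ¬ A α
    missing-at-u = count-witness (λ γ → ¬? (seen? u γ)) (complement (seen? u) _ (excluded-middle (seen? u)) (begin
      count (seen? u) + 1   ≤⟨ +-monoˡ-≤ 1 #A≤ ⟩
      a₀ + 1 + 1            ≡⟨ +-assoc a₀ 1 1 ⟩
      a₀ + 2                ≤⟨ +-monoʳ-≤ a₀ 2≤D ⟩
      a₀ + D                ∎))
      where open ≤-Reasoning

    -- Step 4: let uy be an edge of colour β ∉ B.  Then the colours seen at y
    -- are exactly β and those missing at u.
    module Partner (y : V) (β : Fin k) (u–y : Edge H u y) (c-uy : col c u y ≡ β) (β∉B : ¬ B β) where

      β∈A : A β
      β∈A = y , u–y , c-uy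

      -- (a) the alternating path for a colour α missing at u would have to
      -- reach u through y, using α at y
      missing-seen : ∀ {α} → ¬ A α → Seen y α
      missing-seen {α} α∉A with seen? y α
      ... | yes s  = s
      ... | no α∉y = ⊥-elim (alternating-path crit c c-proper c-acyclic α≢β
                               (λ u–z e → α∉A (_ , u–z , e)) (λ w–z e → β∉B (_ , w–z , e)) no-path)
        where
        α≢β : ¬ α ≡ β
        α≢β e = α∉A (subst A (sym e) β∈A)
        no-path : ¬ AltPath c α β
        no-path P with path-last P
        ... | z , u–z , inj₁ e = α∉A (z , u–z , e)
        ... | z , u–z , inj₂ (e , z′ , z–z′ , e′) =
          α∉y (subst (λ t → Seen t α) (c-unique u–z u–y (trans e (sym c-uy))) (z′ , z–z′ , e′))

      -- (b) then y has no room for another colour of A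
      others-unseen : ∀ {γ} → A γ → ¬ γ ≡ β → ¬ Seen y γ
      others-unseen {γ} γ∈A γ≢β γ∈y = 1+n≰n (+-cancelˡ-≤ (a₀ + D) 2 1 (begin
        a₀ + D + 2                                   ≤⟨ +-monoˡ-≤ 2 (subst (_≤ #A + #¬A) k≡a₀+D
                                                            (count-cover (seen? u) ¬A? (excluded-middle (seen? u)))) ⟩
        #A + #¬A + 2                                 ≡⟨ +-assoc #A #¬A 2 ⟩
        #A + (#¬A + 2)                               ≤⟨ +-mono-≤ #A≤ (≤-trans #¬A+2≤#y (#seen≤D y)) ⟩
        a₀ + 1 + D                                   ≡⟨ xy∙z≈xz∙y a₀ 1 D ⟩
        a₀ + D + 1                                   ∎))
        where
        open ≤-Reasoning
        ¬A? : ∀ δ → Dec (¬ A δ)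
        ¬A? δ = ¬? (seen? u δ)
        #A #¬A : ℕ
        #A = count (seen? u)
        #¬A = count ¬A?
        βγ? : ∀ δ → Dec (δ ≡ β ⊎ δ ≡ γ)
        βγ? δ = (δ ≟ᶠ β) ⊎-dec (δ ≟ᶠ γ)
        #¬A+2≤#y : #¬A + 2 ≤ count (seen? y)
        #¬A+2≤#y = begin
          #¬A + 2                                    ≡⟨ cong₂ (λ s t → #¬A + (s + t)) (count-singleton β) (count-singleton γ) ⟨
          #¬A + (count (_≟ᶠ β) + count (_≟ᶠ γ))       ≤⟨ +-monoʳ-≤ #¬A (count-disjoint (_≟ᶠ β) (_≟ᶠ γ)
                                                          (λ δ (δ≡β , δ≡γ) → γ≢β (trans (sym δ≡γ) δ≡β))) ⟩
          #¬A + count βγ?                            ≤⟨ count-disjoint ¬A? βγ? disjoint ⟩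
          count (λ δ → ¬A? δ ⊎-dec βγ? δ)           ≤⟨ count-mono _ (seen? y) seen-at-y ⟩
          count (seen? y)                            ∎
          where
          disjoint : ∀ δ → ¬ (¬ A δ × (δ ≡ β ⊎ δ ≡ γ))
          disjoint δ (δ∉A , inj₁ refl) = δ∉A β∈A
          disjoint δ (δ∉A , inj₂ refl) = δ∉A γ∈A
          seen-at-y : ∀ {δ} → ¬ A δ ⊎ (δ ≡ β ⊎ δ ≡ γ) → Seen y δ
          seen-at-y (inj₁ δ∉A)        = missing-seen δ∉A
          seen-at-y (inj₂ (inj₁ refl)) = u , edge-sym H u–y , trans (colSym c y u (edge-sym H u–y)) c-uy
          seen-at-y (inj₂ (inj₂ refl)) = γ∈y

    module Swap (y₁ y₂ : V) (β₁ β₂ : Fin k) (u–y₁ : Edge H u y₁) (u–y₂ : Edge H u y₂)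
      (c-uy₁ : col c u y₁ ≡ β₁) (c-uy₂ : col c u y₂ ≡ β₂) (β₁∉B : ¬ B β₁) (β₂∉B : ¬ B β₂)
      (β₁≢β₂ : ¬ β₁ ≡ β₂) where

      open Partner y₁ β₁ u–y₁ c-uy₁ β₁∉B using () renaming (β∈A to β₁∈A; others-unseen to others-unseen₁)
      open Partner y₂ β₂ u–y₂ c-uy₂ β₂∉B using () renaming (β∈A to β₂∈A; others-unseen to others-unseen₂)

      τ : Fin k → Fin k
      τ = transpose β₁ β₂

      τ-injective : ∀ {s t} → τ s ≡ τ t → s ≡ t
      τ-injective {s} {t} e =
        trans (sym (transpose-inverse β₂ β₁)) (trans (cong (transpose β₂ β₁) e) (transpose-inverse β₂ β₁))

      data Transposed (t : Fin k) : Set where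
        swapped₁ : t ≡ β₁ → τ t ≡ β₂ → Transposed t
        swapped₂ : t ≡ β₂ → τ t ≡ β₁ → Transposed t
        fixed    : ¬ t ≡ β₁ → ¬ t ≡ β₂ → τ t ≡ t → Transposed t

      τβ₁ : τ β₁ ≡ β₂
      τβ₁ rewrite dec-true (β₁ ≟ᶠ β₁) refl = refl

      τβ₂ : τ β₂ ≡ β₁
      τβ₂ rewrite dec-false (β₂ ≟ᶠ β₁) (β₁≢β₂ ∘ sym) | dec-true (β₂ ≟ᶠ β₂) refl = refl

      transposed : ∀ t → Transposed t
      transposed t with t ≟ᶠ β₁ | t ≟ᶠ β₂
      ... | yes refl | _        = swapped₁ refl τβ₁
      ... | no _     | yes refl = swapped₂ refl τβ₂
      ... | no t≢β₁  | no t≢β₂  = fixed t≢β₁ t≢β₂ τt≡t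
        where
        τt≡t : τ t ≡ t
        τt≡t rewrite dec-false (t ≟ᶠ β₁) t≢β₁ | dec-false (t ≟ᶠ β₂) t≢β₂ = refl

      τ-other : ∀ {z} → Edge H u z → ¬ z ≡ y₁ → ¬ z ≡ y₂ → τ (col c u z) ≡ col c u z
      τ-other {z} u–z z≢y₁ z≢y₂ with transposed (col c u z)
      ... | swapped₁ e _ = ⊥-elim (z≢y₁ (c-unique u–z u–y₁ (trans e (sym c-uy₁))))
      ... | swapped₂ e _ = ⊥-elim (z≢y₂ (c-unique u–z u–y₂ (trans e (sym c-uy₂))))
      ... | fixed _ _ e  = e

      sw : V → V → Fin k
      sw x y with x ≟ᶠ u | y ≟ᶠ u
      ... | yes _ | _     = τ (col c u y)
      ... | no _  | yes _ = τ (col c x u)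
      ... | no _  | no _  = col c x y

      sw-from-u : ∀ y → sw u y ≡ τ (col c u y)
      sw-from-u y with u ≟ᶠ u
      ... | yes _  = refl
      ... | no u≢u = ⊥-elim (u≢u refl)

      sw-to-u : ∀ {x} → ¬ x ≡ u → sw x u ≡ τ (col c x u)
      sw-to-u {x} x≢u with x ≟ᶠ u | u ≟ᶠ u
      ... | yes x≡u | _      = ⊥-elim (x≢u x≡u)
      ... | no _    | yes _  = refl
      ... | no _    | no u≢u = ⊥-elim (u≢u refl)

      sw-away : ∀ {x y} → ¬ x ≡ u → ¬ y ≡ u → sw x y ≡ col c x y
      sw-away {x} {y} x≢u y≢u with x ≟ᶠ u | y ≟ᶠ u
      ... | yes x≡u | _       = ⊥-elim (x≢u x≡u)
      ... | no _    | yes y≡u = ⊥-elim (y≢u y≡u)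
      ... | no _    | no _    = refl

      sw-sym : ∀ x y → Edge H x y → sw x y ≡ sw y x
      sw-sym x y x–y = by-cases (x ≟ᶠ u) (y ≟ᶠ u)
        where
        by-cases : Dec (x ≡ u) → Dec (y ≡ u) → sw x y ≡ sw y x
        by-cases (yes refl) (yes refl) = refl
        by-cases (yes refl) (no y≢u)   = trans (sw-from-u y) (trans (cong τ (colSym c u y x–y)) (sym (sw-to-u y≢u)))
        by-cases (no x≢u)   (yes refl) = trans (sw-to-u x≢u) (trans (cong τ (colSym c x u x–y)) (sym (sw-from-u x)))
        by-cases (no x≢u)   (no y≢u)   = trans (sw-away x≢u y≢u) (trans (colSym c x y x–y) (sym (sw-away y≢u x≢u)))

      swapped : EdgeColouring H k
      swapped = record { col = sw ; colSym = sw-sym }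

      sw-unchanged : ∀ {x y} → Edge H x y → (x ≡ u → ¬ y ≡ y₁ × ¬ y ≡ y₂) → (y ≡ u → ¬ x ≡ y₁ × ¬ x ≡ y₂) →
        sw x y ≡ col c x y
      sw-unchanged {x} {y} x–y at-x at-y = by-cases (x ≟ᶠ u) (y ≟ᶠ u)
        where
        by-cases : Dec (x ≡ u) → Dec (y ≡ u) → sw x y ≡ col c x y
        by-cases (yes refl) _ = let (y≢y₁ , y≢y₂) = at-x refl in trans (sw-from-u y) (τ-other x–y y≢y₁ y≢y₂)
        by-cases (no x≢u) (yes refl) = let (x≢y₁ , x≢y₂) = at-y refl in
          trans (sw-to-u x≢u) (trans (cong τ (colSym c x y x–y))
                (trans (τ-other (edge-sym H x–y) x≢y₁ x≢y₂) (colSym c y x (edge-sym H x–y))))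
        by-cases (no x≢u) (no y≢u) = sw-away x≢u y≢u

      sw-fresh : ∀ {x z} → Edge H x u → Edge H x z → ¬ z ≡ u → ¬ τ (col c x u) ≡ col c x z
      sw-fresh {x} {z} x–u x–z z≢u with transposed (col c x u)
      ... | swapped₁ e τ≡ = λ e′ →
        others-unseen₁ β₂∈A (β₁≢β₂ ∘ sym) (subst (λ t → Seen t β₂) x≡y₁ (z , x–z , trans (sym e′) τ≡))
        where
        x≡y₁ : x ≡ y₁
        x≡y₁ = c-unique (edge-sym H x–u) u–y₁ (trans (colSym c u x (edge-sym H x–u)) (trans e (sym c-uy₁)))
      ... | swapped₂ e τ≡ = λ e′ →
        others-unseen₂ β₁∈A β₁≢β₂ (subst (λ t → Seen t β₁) x≡y₂ (z , x–z , trans (sym e′) τ≡))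
        where
        x≡y₂ : x ≡ y₂
        x≡y₂ = c-unique (edge-sym H x–u) u–y₂ (trans (colSym c u x (edge-sym H x–u)) (trans e (sym c-uy₂)))
      ... | fixed _ _ τ≡ = λ e′ → c-proper x u z x–u x–z (z≢u ∘ sym) (trans (sym τ≡) e′)

      swapped-proper : Proper swapped
      swapped-proper x y z x–y x–z y≢z = at-x (x ≟ᶠ u)
        where
        at-x : Dec (x ≡ u) → ¬ sw x y ≡ sw x z
        at-x (yes refl) e = c-proper x y z x–y x–z y≢z (τ-injective (trans (sym (sw-from-u y)) (trans e (sw-from-u z))))
        at-x (no x≢u) = at-yz (y ≟ᶠ u) (z ≟ᶠ u)
          where
          at-yz : Dec (y ≡ u) → Dec (z ≡ u) → ¬ sw x y ≡ sw x z
          at-yz (yes refl) (yes refl) _ = y≢z refl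
          at-yz (yes refl) (no z≢u) e =
            sw-fresh x–y x–z z≢u (trans (sym (sw-to-u x≢u)) (trans e (sw-away x≢u z≢u)))
          at-yz (no y≢u) (yes refl) e =
            sw-fresh x–z x–y y≢u (trans (sym (sw-to-u x≢u)) (trans (sym e) (sw-away x≢u y≢u)))
          at-yz (no y≢u) (no z≢u) e =
            c-proper x y z x–y x–z y≢z (trans (sym (sw-away x≢u y≢u)) (trans e (sw-away x≢u z≢u)))

      -- A two-coloured cycle of the swapped colouring leaving u along uy
      -- (y one of y₁, y₂, the other being y′) cannot exist: it alternates
      -- between the new colour β′ of uy and the colour γ of its second edge,
      -- so it returns to u along an edge of colour γ, contradicting Step 4 or
      -- the properness of c.
      module NoCycleVia (y y′ : V) (β β′ : Fin k) (u–y : Edge H u y)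
        (c-uy : col c u y ≡ β) (c-uy′ : col c u y′ ≡ β′) (τβ : τ β ≡ β′)
        (unseen-at-y : ∀ {γ} → A γ → ¬ γ ≡ β → ¬ Seen y γ)
        (fixed-at-u : ∀ {z} → Edge H u z → ¬ z ≡ y → ¬ z ≡ y′ → τ (col c u z) ≡ col c u z)
        (S : CycleSeq H) {a b} (tc : TwoColoured swapped a b S) (r0 : r S 0 ≡ u) (r1 : r S 1 ≡ y) where

        L : ℕ
        L = len S
        z x : V
        z = r S (suc L)
        x = r S (2 + L)

        off-u : ∀ {j} → 0 < j → j < 3 + L → ¬ r S j ≡ u
        off-u {suc j} _ j<N e with inj S j<N (s≤s z≤n) (trans e (sym r0))
        ... | ()

        y–r2 : Edge H y (r S 2)
        y–r2 = subst (λ t → Edge H t (r S 2)) r1 (edge S (s≤s (s≤s z≤n)))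

        γ : Fin k
        γ = col c y (r S 2)

        sw-uy : sw u y ≡ β′
        sw-uy = trans (sw-from-u y) (trans (cong τ c-uy) τβ)

        first : sw (r S 0) (r S 1) ≡ β′
        first = trans (cong₂ sw r0 r1) sw-uy

        second : sw (r S 1) (r S 2) ≡ γ
        second = trans (cong (λ t → sw t (r S 2)) r1)
                       (sw-away (λ e → off-u (s≤s z≤n) (s≤s (s≤s z≤n)) (trans r1 e))
                                (off-u (s≤s z≤n) (s≤s (s≤s (s≤s z≤n)))))

        β′≢γ : ¬ β′ ≡ γ
        β′≢γ e = swapped-proper (r S 1) (r S 0) (r S 2) (edge-sym H (edge S (s≤s z≤n))) (edge S (s≤s (s≤s z≤n)))
                   (λ e′ → off-u (s≤s z≤n) (s≤s (s≤s (s≤s z≤n))) (trans (sym e′) r0))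
                   (trans (sw-sym (r S 1) (r S 0) (edge-sym H (edge S (s≤s z≤n)))) (trans first (trans e (sym second))))

        colours : ∀ {j} → j < 3 + L → sw (r S j) (r S (suc j)) ≡ alt β′ γ j
        colours = alternating {c = swapped} swapped-proper S tc (subst (OneOf a b) first (tc (s≤s z≤n)))
                    (subst (OneOf a b) second (tc (s≤s (s≤s z≤n)))) β′≢γ first

        x–u : Edge H x u
        x–u = edge-sym H (subst (λ t → Edge H t x) r0 (edge-to-last S))

        x≢u : ¬ x ≡ u
        x≢u = off-u (s≤s z≤n) ≤-refl

        x≢y : ¬ x ≡ y
        x≢y e = second≢last S (trans r1 (sym e))

        z–x : Edge H z x
        z–x = edge S (s≤s (s≤s (n≤1+n L)))

        z≢u : ¬ z ≡ u
        z≢u = off-u (s≤s z≤n) (s≤s (s≤s (n≤1+n L)))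

        last : sw x u ≡ alt γ β′ (suc L)
        last = subst (λ t → sw x t ≡ alt γ β′ (suc L)) (trans (closed S) r0) (colours ≤-refl)

        last-two : alt β′ γ (suc L) ≡ β′ × alt γ β′ (suc L) ≡ γ
        last-two with alt-cases β′ γ (suc L)
        ... | inj₁ es = es
        ... | inj₂ (_ , e) = ⊥-elim (swapped-proper u x y (edge-sym H x–u) u–y x≢y
                               (trans (sw-sym u x (edge-sym H x–u)) (trans last (trans e (sym sw-uy)))))

        impossible : ⊥
        impossible with x ≟ᶠ y′
        ... | yes refl = c-proper x z u (edge-sym H z–x) x–u z≢u (begin
          col c x z           ≡⟨ colSym c x z (edge-sym H z–x) ⟩
          col c z x           ≡⟨ sw-away z≢u x≢u ⟨
          sw z x              ≡⟨ colours (s≤s (s≤s (n≤1+n L))) ⟩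
          alt β′ γ (suc L)    ≡⟨ proj₁ last-two ⟩
          β′                  ≡⟨ c-uy′ ⟨
          col c u x           ≡⟨ colSym c x u x–u ⟨
          col c x u           ∎)
          where open ≡-Reasoning
        ... | no x≢y′ = unseen-at-y γ∈A γ≢β (r S 2 , y–r2 , refl)
          where
          c-ux≡γ : col c u x ≡ γ
          c-ux≡γ = begin
            col c u x         ≡⟨ fixed-at-u (edge-sym H x–u) x≢y x≢y′ ⟨
            τ (col c u x)     ≡⟨ cong τ (colSym c u x (edge-sym H x–u)) ⟩
            τ (col c x u)     ≡⟨ sw-to-u x≢u ⟨
            sw x u            ≡⟨ last ⟩
            alt γ β′ (suc L)  ≡⟨ proj₂ last-two ⟩
            γ                 ∎
            where open ≡-Reasoning
          γ∈A : A γ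
          γ∈A = x , edge-sym H x–u , c-ux≡γ
          γ≢β : ¬ γ ≡ β
          γ≢β e = x≢y (c-unique (edge-sym H x–u) u–y (trans c-ux≡γ (trans e (sym c-uy))))

      via₁ : (S : CycleSeq H) → ∀ {a b} → TwoColoured swapped a b S → r S 0 ≡ u → r S 1 ≡ y₁ → ⊥
      via₁ S tc r0 r1 = NoCycleVia.impossible y₁ y₂ β₁ β₂ u–y₁ c-uy₁ c-uy₂ τβ₁ others-unseen₁ τ-other S tc r0 r1
      via₂ : (S : CycleSeq H) → ∀ {a b} → TwoColoured swapped a b S → r S 0 ≡ u → r S 1 ≡ y₂ → ⊥
      via₂ S tc r0 r1 = NoCycleVia.impossible y₂ y₁ β₂ β₁ u–y₂ c-uy₂ c-uy₁ τβ₂ others-unseen₂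
                          (λ u–z z≢y₂ z≢y₁ → τ-other u–z z≢y₁ z≢y₂) S tc r0 r1

      -- A two-coloured cycle through u either uses one of the swapped edges
      -- (read it so that it leaves u along that edge) or is two-coloured in c.
      no-cycle-through-u : (S : CycleSeq H) → ∀ {a b} → TwoColoured swapped a b S → r S 0 ≡ u → ⊥
      no-cycle-through-u S tc r0 with r S 1 ≟ᶠ y₁ | r S 1 ≟ᶠ y₂
      ... | yes r1 | _      = via₁ S tc r0 r1
      ... | no _   | yes r1 = via₂ S tc r0 r1
      ... | no r1≢y₁ | no r1≢y₂ with r S (2 + len S) ≟ᶠ y₁ | r S (2 + len S) ≟ᶠ y₂
      ...   | yes rL | _      = via₁ (reverse S) (reverse-twoColoured {c = swapped} S tc) (trans (closed S) r0) rL
      ...   | no _   | yes rL = via₂ (reverse S) (reverse-twoColoured {c = swapped} S tc) (trans (closed S) r0) rL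
      ...   | no rL≢y₁ | no rL≢y₂ =
        acyclic-noTwoColoured {c = c} c-acyclic S (λ j<N → subst (OneOf _ _) (unchanged j<N) (tc j<N))
        where
        at-start : ∀ {j} → j < 3 + len S → r S j ≡ u → j ≡ 0
        at-start j<N e = inj S j<N (s≤s z≤n) (trans e (sym r0))
        unchanged : ∀ {j} → j < 3 + len S → sw (r S j) (r S (suc j)) ≡ col c (r S j) (r S (suc j))
        unchanged {j} j<N = sw-unchanged (edge S j<N) leaving entering
          where
          leaving : r S j ≡ u → ¬ r S (suc j) ≡ y₁ × ¬ r S (suc j) ≡ y₂
          leaving e with at-start j<N e
          ... | refl = r1≢y₁ , r1≢y₂
          entering : r S (suc j) ≡ u → ¬ r S j ≡ y₁ × ¬ r S j ≡ y₂
          entering e with suc j <? 3 + len S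
          ... | yes 1+j<N with at-start 1+j<N e
          ...   | ()
          entering e | no 1+j≮N with suc-injective (≤-antisym j<N (≮⇒≥ 1+j≮N))
          ...   | refl = rL≢y₁ , rL≢y₂

      swapped-acyclic : Acyclic swapped
      swapped-acyclic C (a , b , bc) with any? (λ i → p C i ≟ᶠ u)
      ... | yes (i , pi≡u) = no-cycle-through-u (rotate C i) (rotate-twoColoured {c = swapped} C i bc) pi≡u
      ... | no avoids-u = c-acyclic C (a , b , λ i → subst (OneOf a b) (sw-away (off i) (off (next i))) (bc i))
        where
        off : ∀ i → ¬ p C i ≡ u
        off i e = avoids-u (i , e)

      -- Step 6: for a colour α missing at u, both c and the swapped colouring
      -- have an (α, β₁)-alternating path from w to u.  Both follow the same
      -- edges until the swapped one enters u; it does so through y₂ in colour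
      -- β₁, so the path in c uses colour β₁ at y₂, contradicting Step 4.
      module Compare (α : Fin k) (α∉A : ¬ A α) where

        α≢β₁ : ¬ α ≡ β₁
        α≢β₁ e = α∉A (subst A (sym e) β₁∈A)

        sw-α-free : ∀ {z} → Edge H u z → ¬ sw u z ≡ α
        sw-α-free {z} u–z e with transposed (col c u z)
        ... | swapped₁ _ τ≡ = α∉A (subst A (trans (sym τ≡) (trans (sym (sw-from-u z)) e)) β₂∈A)
        ... | swapped₂ _ τ≡ = α∉A (subst A (trans (sym τ≡) (trans (sym (sw-from-u z)) e)) β₁∈A)
        ... | fixed _ _ τ≡  = α∉A (z , u–z , trans (sym τ≡) (trans (sym (sw-from-u z)) e))

        -- w is neither y₁ nor y₂ (their edge to u has a colour outside B)
        w≢partner : ∀ {y β} → Edge H u y → col c u y ≡ β → ¬ B β → ¬ w ≡ y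
        w≢partner {y} u–y c-uy β∉B refl = β∉B (u , edge-sym H u–y , trans (colSym c y u (edge-sym H u–y)) c-uy)

        sw-at-w : ∀ {z} → Edge H w z → sw w z ≡ col c w z
        sw-at-w w–z = sw-unchanged w–z (λ w≡u → ⊥-elim (w≢u w≡u))
                        (λ _ → w≢partner u–y₁ c-uy₁ β₁∉B , w≢partner u–y₂ c-uy₂ β₂∉B)

        -- Before Q reaches u, its edges keep their colour from c, and by
        -- properness of c each step of P and Q is determined by the colour.
        paths-agree : (P : AltPath c α β₁) (Q : AltPath swapped α β₁) →
          ∀ j → j < AltPath.m Q → j ≤ AltPath.m P → AltPath.q P j ≡ AltPath.q Q j
        paths-agree P Q zero _ _ = trans (AltPath.start P) (sym (AltPath.start Q))
        paths-agree P Q (suc j) 1+j<mQ 1+j≤mP =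
          c-unique (AltPath.step P 1+j≤mP) Q-edge (trans (AltPath.colour P 1+j≤mP) (sym Q-colour))
          where
          open AltPath Q
          j<mQ : j < m
          j<mQ = <-trans (n<1+n j) 1+j<mQ
          same : AltPath.q P j ≡ q j
          same = paths-agree P Q j j<mQ (≤-trans (n≤1+n j) 1+j≤mP)
          Q-edge : Edge H (AltPath.q P j) (q (suc j))
          Q-edge = subst (λ t → Edge H t (q (suc j))) (sym same) (step j<mQ)
          Q-colour : col c (AltPath.q P j) (q (suc j)) ≡ alt α β₁ j
          Q-colour = subst (λ t → col c t (q (suc j)) ≡ alt α β₁ j) (sym same)
                       (trans (sym (sw-away (avoids j<mQ) (avoids 1+j<mQ))) (colour j<mQ))

        -- Q cannot be shorter than P (else P would meet u early), so when Q
        -- enters u through y₂ in colour β₁, P leaves y₂ in colour β₁.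
        impossible : AltPath c α β₁ → AltPath swapped α β₁ → ⊥
        impossible P Q with AltPath.m P <? AltPath.m Q
        ... | yes mP<mQ = AltPath.avoids Q mP<mQ (trans (sym (paths-agree P Q _ mP<mQ ≤-refl)) (AltPath.end P))
        ... | no mP≮mQ = from (AltPath.m Q) refl
          where
          open AltPath Q
          last-edge : ∀ i → suc i ≡ m → Edge H u (q i) × sw u (q i) ≡ alt α β₁ i
          last-edge i 1+i≡m =
            u–z , trans (sw-sym u (q i) u–z) (subst (λ t → sw (q i) t ≡ alt α β₁ i) arrive (colour i<m))
            where
            i<m : i < m
            i<m = subst (i <_) 1+i≡m ≤-refl
            arrive : q (suc i) ≡ u
            arrive = subst (λ t → q t ≡ u) (sym 1+i≡m) end
            u–z : Edge H u (q i)
            u–z = edge-sym H (subst (Edge H (q i)) arrive (step i<m))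
          from : ∀ t → t ≡ m → ⊥
          from zero 0≡m = <-irrefl 0≡m (path-nonempty Q)
          from (suc i) 1+i≡m with last-edge i 1+i≡m | alt-cases α β₁ i
          ... | u–z , colour-in | inj₁ (e , _) = sw-α-free u–z (trans colour-in e)
          ... | u–z , colour-in | inj₂ (e , _) = others-unseen₂ β₁∈A β₁≢β₂
                                 (subst (λ t → Seen t β₁) P-at-y₂ (_ , AltPath.step P i<mP , trans (AltPath.colour P i<mP) e))
            where
            i<mP : i < AltPath.m P
            i<mP = ≤-trans (subst (_≤ m) (sym 1+i≡m) ≤-refl) (≮⇒≥ mP≮mQ)
            sw-uy₂ : sw u y₂ ≡ β₁
            sw-uy₂ = trans (sw-from-u y₂) (trans (cong τ c-uy₂) τβ₂)
            z≡y₂ : q i ≡ y₂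
            z≡y₂ = proper-unique {c = swapped} swapped-proper u–z u–y₂ (trans colour-in (trans e (sym sw-uy₂)))
            P-at-y₂ : AltPath.q P i ≡ y₂
            P-at-y₂ = trans (paths-agree P Q i (subst (i <_) 1+i≡m ≤-refl) (<⇒≤ i<mP)) z≡y₂

        contradiction : ⊥
        contradiction =
          alternating-path crit c c-proper c-acyclic α≢β₁
            (λ u–z e → α∉A (_ , u–z , e)) (λ w–z e → β₁∉B (_ , w–z , e)) λ P →
          alternating-path crit swapped swapped-proper swapped-acyclic α≢β₁ sw-α-free
            (λ w–z e → β₁∉B (_ , w–z , trans (sym (sw-at-w w–z)) e)) λ Q →
          impossible P Q

    contradiction : ⊥
    contradiction =
      let (β₁ , β₂ , ((y₁ , u–y₁ , c-uy₁) , β₁∉B) , ((y₂ , u–y₂ , c-uy₂) , β₂∉B) , β₁≢β₂) = two-in-A∖B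
          (α , α∉A) = missing-at-u
      in Swap.Compare.contradiction y₁ y₂ β₁ β₂ u–y₁ u–y₂ c-uy₁ c-uy₂ β₁∉B β₂∉B β₁≢β₂ α α∉A

lemma3p5 : (G : Graph) (k : ℕ) → AcyclicallyEdgeCritical G k → Δ G < k →
    (v : Fin (n G)) → deg G v ≡ 2 →
    (u : Fin (n G)) → Edge G v u → (k ∸ Δ G) + 3 ≤ deg G u
lemma3p5 G k crit Δ<k v deg-v u v–u with (k ∸ Δ G) + 3 ≤? deg G u
... | yes bound = bound
... | no ¬bound =
  let (w , v–w , w≢u , nbrs) = other-neighbour G deg-v v–u
      (c , c-proper , c-acyclic) = proj₂ crit (H-subgraph G v) (H-proper G v v–u)
  in ⊥-elim (TwoNeighbours.Counterexample.contradiction G k v u w v–u v–w w≢u nbrs crit c c-proper c-acyclic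
       (Δ G) (k ∸ Δ G) (sym (m∸n+n≡m (<⇒≤ Δ<k))) (subst (_≤ Δ G) deg-v (deg≤Δ G v)) (m<n⇒0<n∸m Δ<k)
       (deg≤Δ G) (≤-pred (subst (suc (deg G u) ≤_) (+-suc (k ∸ Δ G) 2) (≰⇒> ¬bound))))
  where open DeleteEdgesAt using (H-subgraph; H-proper)
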